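{- Let $G=(V(G),E(G))$ be a finite simple graph and let $t,n$ be positive integers such that $n-t\ge 0$ and $n-t$ is even. Then the independence number of the shuriken graph satisfies $$\alpha(Shu^t_n(G))=t+\frac{n-t}{2}\bigl(\alpha(G)+1\bigr).$$
   Context: The $(t,n)$-shuriken graph $Shu^t_n(G)$ (for positive integers $t,n$ with $n-t\ge 0$ even) is the simple graph constructed as follows. Add a new vertex $z$ to $G$ and take $n$ copies $G'_1,\dots,G'_n$ of the resulting vertex set $V(G)\cup\{z\}$; for $x\in V(G)\cup\{z\}$ and $1\le i\le n$, write $x_i$ for the copy of $x$ in $G'_i$. The vertex set is $\bigcup_{i=1}^n\{z_i, v_i : v\in V(G)\}$. The edge set consists of: (1) $u_iv_j$ for every edge $uv\in E(G)$ and all $i,j\in\{1,\dots,n\}$ (including $i=j$); (2) for each $i\in\{1,\dots,t\}$, all edges $u_iv_i$ between distinct vertices $u_i\neq v_i$ of $G'_i$; (3) for each $i\in\{t+1,\dots,\frac{n+t}{2}\}$, all edges $u_iv_{n+t+1-i}$ with $u_i\in V(G'_i)$ and $v_{n+t+1-i}\in V(G'_{n+t+1-i})$. $\alpha(H)$ denotes the independence number (maximum size of a set of pairwise non-adjacent vertices) of a graph $H$. -}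

module Defs where

open import Data.Nat using (ℕ; _+_; _∸_; _≤_; _<_)
open import Data.Fin using (Fin; toℕ)
open import Data.Maybe using (Maybe; just; nothing)
open import Data.Product using (_×_; _,_; ∃)
open import Data.Sum using (_⊎_)
open import Data.List using (List; length)
open import Data.List.Relation.Unary.Unique.Propositional using (Unique)
open import Data.List.Membership.Propositional using (_∈_)
open import Relation.Binary.PropositionalEquality using (_≡_; _≢_)
open import Relation.Nullary using (¬_)

record SimpleGraph (V : Set) : Set₁ where
  field
    Adj    : V → V → Set
    sym    : ∀ {u v} → Adj u v → Adj v u
    irrefl : ∀ {v} → ¬ Adj v v
open SimpleGraph public

IsIndependent : ∀ {V : Set} → (V → V → Set) → List V → Set
IsIndependent A xs = Unique xs × (∀ {u v} → u ∈ xs → v ∈ xs → ¬ A u v)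

IsIndependenceNumber : ∀ {V : Set} → (V → V → Set) → ℕ → Set
IsIndependenceNumber A k =
  (∃ λ xs → IsIndependent A xs × length xs ≡ k) ×
  (∀ xs → IsIndependent A xs → length xs ≤ k)

-- Vertices of Shu^t_n(G) for G on Fin m: a copy index i (0-based: copy G'_{i+1})
-- and either nothing (= z) or just v (= v ∈ V(G)).
ShuV : ℕ → ℕ → Set
ShuV n m = Fin n × Maybe (Fin m)

-- Adjacency of the shuriken graph Shu^t_n(G) (0-based copy indices, copy I = i+1):
-- (1) u_i v_j for uv ∈ E(G), all i, j;
-- (2) for copies I ∈ {1..t}: all pairs of distinct vertices of G'_I;
-- (3) for I ∈ {t+1..(n+t)/2}: all pairs between G'_I and G'_{n+t+1-I}
--     (taken symmetrically; 0-based: t ≤ i, t ≤ j, i + j = n + t - 1).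
ShuAdj : ∀ {m} (t n : ℕ) → SimpleGraph (Fin m) → ShuV n m → ShuV n m → Set
ShuAdj t n G (i , x) (j , y) =
  (∃ λ u → ∃ λ v → x ≡ just u × y ≡ just v × Adj G u v)
  ⊎ ((i ≡ j × toℕ i < t × x ≢ y)
  ⊎ (t ≤ toℕ i × t ≤ toℕ j × toℕ i + toℕ j ≡ n + t ∸ 1))

{-# OPTIONS --safe #-}

-- Write n = t + 2k. Copy i < t is a clique, and for e < k the copies t + e and t + 2k − 1 − e
-- are completely joined. An independent set X therefore has at most one vertex in each clique
-- copy and, inside the e-th pair, lives in a single copy. Edges of type (1) join all copies, so
-- the G-vertices occurring anywhere in X form an independent set S of G. Sending a vertex to
-- its clique copy, or to (e, its label in {z} ∪ S), is injective on X, whence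
-- |X| ≤ t + k (|S| + 1) ≤ t + k (α(G) + 1). Conversely, z in each clique copy together with
-- z and a maximum independent set of G in each of the copies t, …, t + k − 1 is independent.
module Submission where

open import Defs using (SimpleGraph; Adj; IsIndependent; IsIndependenceNumber; ShuV; ShuAdj)
open import Data.Nat using (ℕ; zero; suc; _+_; _*_; _∸_; _≤_; _<_; _/_; s≤s)
open import Data.Nat.Properties
  using (+-comm; *-comm; +-identityʳ; m+[n∸m]≡n; m≤m+n; m≤n+m∸n; +-monoʳ-≤; +-mono-≤; *-monoʳ-≤;
         ≤-trans; <-irrefl; <⇒≱; module ≤-Reasoning)
open import Data.Nat.DivMod using (m*n/n≡m)
open import Data.Nat.Tactic.RingSolver using (solve-∀)
open import Data.Fin using (Fin; zero; suc; toℕ; _↑ˡ_; _↑ʳ_; splitAt; combine; opposite)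
open import Data.Fin.Properties
  using (toℕ<n; toℕ-↑ˡ; toℕ-↑ʳ; ↑ˡ-injective; ↑ʳ-injective; splitAt-↑ˡ; splitAt-↑ʳ;
         combine-injective; opposite-prop; opposite-involutive; injective⇒≤; suc-injective)
  renaming (_≟_ to _≟ᶠ_)
open import Data.Maybe using (Maybe; just; nothing)
open import Data.Maybe.Properties using (just-injective) renaming (≡-dec to ≡-decᴹ)
open import Data.Maybe.Relation.Unary.All as Maybe using (just; nothing)
open import Data.Product using (∃; _×_; _,_; proj₁; proj₂)
open import Data.Sum using (inj₁; inj₂)
open import Data.Empty using (⊥; ⊥-elim)
open import Data.List using (List; []; _∷_; length; map; _++_; filter; allFin; cartesianProductWith; lookup)
open import Data.List.Properties using (length-map; length-++; length-tabulate)
import Data.List.Relation.Unary.Any as Any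
import Data.List.Relation.Unary.All as All
import Data.List.Relation.Unary.All.Properties as All
open import Data.List.Relation.Unary.Unique.Propositional using (Unique; _∷_)
import Data.List.Relation.Unary.Unique.Propositional.Properties as Unique
open import Data.List.Membership.Propositional using (_∈_)
open import Data.List.Membership.Propositional.Properties
  using (∈-lookup; ∈-map⁺; ∈-map⁻; ∈-filter⁺; ∈-filter⁻; ∈-allFin; ∈-++⁻; ∈-cartesianProductWith⁻)
import Data.List.Membership.DecPropositional as DecMembership
open import Data.List.Membership.Setoid.Properties using (index-injective)
open import Relation.Binary.PropositionalEquality
open import Relation.Nullary using (¬_; yes; no)
open import Relation.Unary using (Decidable)

private
  variable
    A B C : Set

lookup-injective : {xs : List A} → Unique xs → ∀ i j → lookup xs i ≡ lookup xs j → i ≡ j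
lookup-injective (_ ∷ _)  zero    zero    _  = refl
lookup-injective (x∉ ∷ _) zero    (suc j) eq = ⊥-elim (All.lookup x∉ (∈-lookup j) eq)
lookup-injective (x∉ ∷ _) (suc i) zero    eq = ⊥-elim (All.lookup x∉ (∈-lookup i) (sym eq))
lookup-injective (_ ∷ u)  (suc i) (suc j) eq = cong suc (lookup-injective u i j eq)

injectiveOn⇒length≤ : ∀ {xs : List A} {n} → Unique xs → (f : ∀ {x} → x ∈ xs → Fin n) →
  (∀ {x y} (p : x ∈ xs) (q : y ∈ xs) → f p ≡ f q → x ≡ y) → length xs ≤ n
injectiveOn⇒length≤ {xs = xs} u f f-inj = injective⇒≤ λ {i} {j} eq →
  lookup-injective u i j (f-inj (∈-lookup {xs = xs} i) (∈-lookup {xs = xs} j) eq)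

length-cartesianProductWith : ∀ (f : A → B → C) xs ys →
  length (cartesianProductWith f xs ys) ≡ length xs * length ys
length-cartesianProductWith f []       ys = refl
length-cartesianProductWith f (x ∷ xs) ys = trans (length-++ (map (f x) ys))
  (cong₂ _+_ (length-map (f x) ys) (length-cartesianProductWith f xs ys))

indexMaybe : ∀ {xs : List A} {y} → Maybe.All (_∈ xs) y → Fin (suc (length xs))
indexMaybe nothing  = zero
indexMaybe (just p) = suc (Any.index p)

indexMaybe-injective : ∀ {xs : List A} {y y′} (p : Maybe.All (_∈ xs) y) (q : Maybe.All (_∈ xs) y′) →
  indexMaybe p ≡ indexMaybe q → y ≡ y′
indexMaybe-injective nothing  nothing  _  = refl
indexMaybe-injective (just p) (just q) eq = cong just (index-injective (setoid _) p q (suc-injective eq))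

↑ˡ≢↑ʳ : ∀ {m n} (i : Fin m) (j : Fin n) → i ↑ˡ n ≢ m ↑ʳ j
↑ˡ≢↑ʳ {m} {n} i j eq
  with () ← trans (sym (splitAt-↑ˡ m i n)) (trans (cong (splitAt m) eq) (splitAt-↑ʳ m n j))

data SplitAt (m n : ℕ) : Fin (m + n) → Set where
  left  : (i : Fin m) → SplitAt m n (i ↑ˡ n)
  right : (j : Fin n) → SplitAt m n (m ↑ʳ j)

splitAtView : ∀ m {n} (i : Fin (m + n)) → SplitAt m n i
splitAtView zero    i       = right i
splitAtView (suc m) zero    = left zero
splitAtView (suc m) (suc i) with splitAtView m i
... | left j  = left (suc j)
... | right j = right j

occurs? : ∀ {n m} (xs : List (ShuV n m)) → Decidable (λ u → just u ∈ map proj₂ xs)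
occurs? xs u = DecMembership._∈?_ (≡-decᴹ _≟ᶠ_) (just u) (map proj₂ xs)

shadow : ∀ {n m} → List (ShuV n m) → List (Fin m)
shadow xs = filter (occurs? xs) (allFin _)

∈-shadow : ∀ {n m} {xs : List (ShuV n m)} {i u} → (i , just u) ∈ xs → u ∈ shadow xs
∈-shadow {xs = xs} p = ∈-filter⁺ (occurs? xs) (∈-allFin _) (∈-map⁺ proj₂ p)

shadow-independent : ∀ {m} {G : SimpleGraph (Fin m)} {t n} {xs : List (ShuV n m)} →
  IsIndependent (ShuAdj t n G) xs → IsIndependent (Adj G) (shadow xs)
shadow-independent {m} {xs = xs} (_ , xs-indep) =
  Unique.filter⁺ (occurs? xs) (Unique.allFin⁺ m) , λ u∈ v∈ uv →
  let (x , x∈ , u≡) = ∈-map⁻ proj₂ (proj₂ (∈-filter⁻ (occurs? xs) {xs = allFin m} u∈))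
      (y , y∈ , v≡) = ∈-map⁻ proj₂ (proj₂ (∈-filter⁻ (occurs? xs) {xs = allFin m} v∈))
  in xs-indep x∈ y∈ (inj₁ (_ , _ , sym u≡ , sym v≡ , uv))

module Shuriken {m} (G : SimpleGraph (Fin m)) (t k : ℕ) where

  Vertex : Set
  Vertex = ShuV (t + (k + k)) m

  Shu : Vertex → Vertex → Set
  Shu = ShuAdj t (t + (k + k)) G

  Joined : Fin (t + (k + k)) → Fin (t + (k + k)) → Set
  Joined i j = t ≤ toℕ i × t ≤ toℕ j × toℕ i + toℕ j ≡ (t + (k + k)) + t ∸ 1

  Joined-sym : ∀ {i j} → Joined i j → Joined j i
  Joined-sym {i} {j} (t≤i , t≤j , sum≡) = t≤j , t≤i , trans (+-comm (toℕ j) (toℕ i)) sum≡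

  cliqueCopy : Fin t → Fin (t + (k + k))
  cliqueCopy c = c ↑ˡ (k + k)

  nearCopy farCopy : Fin k → Fin (t + (k + k))
  nearCopy e = t ↑ʳ (e ↑ˡ k)
  farCopy  e = t ↑ʳ (k ↑ʳ opposite e)

  data Copy : Fin (t + (k + k)) → Set where
    clique : (c : Fin t) → Copy (cliqueCopy c)
    near   : (e : Fin k) → Copy (nearCopy e)
    far    : (e : Fin k) → Copy (farCopy e)

  copy : ∀ i → Copy i
  copy i with splitAtView t i
  ... | left c = clique c
  ... | right d with splitAtView k d
  ...   | left e  = near e
  ...   | right e = subst (λ e′ → Copy (t ↑ʳ (k ↑ʳ e′))) (opposite-involutive e) (far (opposite e))

  toℕ-cliqueCopy<t : (c : Fin t) → toℕ (cliqueCopy c) < t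
  toℕ-cliqueCopy<t c = subst (_< t) (sym (toℕ-↑ˡ c (k + k))) (toℕ<n c)

  t≤toℕ-pair : (d : Fin (k + k)) → t ≤ toℕ (t ↑ʳ d)
  t≤toℕ-pair d = subst (t ≤_) (sym (toℕ-↑ʳ t d)) (m≤m+n t (toℕ d))

  toℕ-nearCopy : (e : Fin k) → toℕ (nearCopy e) ≡ t + toℕ e
  toℕ-nearCopy e = trans (toℕ-↑ʳ t (e ↑ˡ k)) (cong (t +_) (toℕ-↑ˡ e k))

  toℕ-farCopy : (e : Fin k) → toℕ (farCopy e) ≡ t + (k + (k ∸ suc (toℕ e)))
  toℕ-farCopy e =
    trans (toℕ-↑ʳ t _) (cong (t +_) (trans (toℕ-↑ʳ k _) (cong (k +_) (opposite-prop e))))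

  near-far-joined : (e : Fin k) → Joined (nearCopy e) (farCopy e)
  near-far-joined e = t≤toℕ-pair _ , t≤toℕ-pair _ , cong (_∸ 1) (begin
    suc (toℕ (nearCopy e) + toℕ (farCopy e))
      ≡⟨ cong₂ (λ a b → suc (a + b)) (toℕ-nearCopy e) (toℕ-farCopy e) ⟩
    suc ((t + a) + (t + (k + (k ∸ suc a))))
      ≡⟨ rearrange t k a (k ∸ suc a) ⟩
    (t + (k + (suc a + (k ∸ suc a)))) + t
      ≡⟨ cong (λ b → (t + (k + b)) + t) (m+[n∸m]≡n (toℕ<n e)) ⟩
    (t + (k + k)) + t ∎)
    where
    open ≡-Reasoning
    a = toℕ e
    rearrange : ∀ t k a b → suc ((t + a) + (t + (k + b))) ≡ (t + (k + (suc a + b))) + t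
    rearrange = solve-∀

  near-near-unjoined : (e e′ : Fin k) → ¬ Joined (nearCopy e) (nearCopy e′)
  near-near-unjoined e e′ (_ , _ , sum≡) = <-irrefl refl (begin
    suc (suc (N ∸ 1))                          ≡⟨ cong (λ s → suc (suc s)) (sym sum≡) ⟩
    suc (suc (toℕ (nearCopy e) + toℕ (nearCopy e′)))
      ≡⟨ cong₂ (λ a b → suc (suc (a + b))) (toℕ-nearCopy e) (toℕ-nearCopy e′) ⟩
    suc (suc ((t + toℕ e) + (t + toℕ e′)))     ≡⟨ rearrange t (toℕ e) (toℕ e′) ⟩
    (t + suc (toℕ e)) + (t + suc (toℕ e′))     ≤⟨ +-mono-≤ (+-monoʳ-≤ t (toℕ<n e)) (+-monoʳ-≤ t (toℕ<n e′)) ⟩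
    (t + k) + (t + k)                          ≡⟨ regroup t k ⟩
    N                                          ≤⟨ m≤n+m∸n N 1 ⟩
    suc (N ∸ 1)                                ∎)
    where
    open ≤-Reasoning
    N = (t + (k + k)) + t
    rearrange : ∀ t a b → suc (suc ((t + a) + (t + b))) ≡ (t + suc a) + (t + suc b)
    rearrange = solve-∀
    regroup : ∀ t k → (t + k) + (t + k) ≡ (t + (k + k)) + t
    regroup = solve-∀

  module UpperBound {xs : List Vertex} (xs-indep : IsIndependent Shu xs) where

    S : List (Fin m)
    S = shadow xs

    label : ∀ {i y} → (i , y) ∈ xs → Maybe.All (_∈ S) y
    label {y = nothing} _ = nothing
    label {y = just u}  p = just (∈-shadow p)

    slot : ∀ {i y} → Copy i → Maybe.All (_∈ S) y → Fin (t + k * suc (length S))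
    slot (clique c) _ = c ↑ˡ _
    slot (near e)   l = t ↑ʳ combine e (indexMaybe l)
    slot (far e)    l = t ↑ʳ combine e (indexMaybe l)

    pair-slot-injective : ∀ {e e′ a b} →
      t ↑ʳ combine {k} {suc (length S)} e a ≡ t ↑ʳ combine e′ b → e ≡ e′ × a ≡ b
    pair-slot-injective eq = combine-injective _ _ _ _ (↑ʳ-injective t _ _ eq)

    slot-injective : ∀ {i j y y′} (p : (i , y) ∈ xs) (q : (j , y′) ∈ xs)
      (ci : Copy i) (cj : Copy j) → slot ci (label p) ≡ slot cj (label q) → (i , y) ≡ (j , y′)
    slot-injective {y = y} {y′} p q (clique c) (clique c′) eq with ↑ˡ-injective _ c c′ eq | ≡-decᴹ _≟ᶠ_ y y′
    ... | refl | yes refl = refl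
    ... | refl | no y≢y′  = ⊥-elim (proj₂ xs-indep p q (inj₂ (inj₁ (refl , toℕ-cliqueCopy<t c , y≢y′))))
    slot-injective p q (clique c) (near _)   eq = ⊥-elim (↑ˡ≢↑ʳ c _ eq)
    slot-injective p q (clique c) (far _)    eq = ⊥-elim (↑ˡ≢↑ʳ c _ eq)
    slot-injective p q (near _)   (clique c) eq = ⊥-elim (↑ˡ≢↑ʳ c _ (sym eq))
    slot-injective p q (far _)    (clique c) eq = ⊥-elim (↑ˡ≢↑ʳ c _ (sym eq))
    slot-injective p q (near e) (near e′) eq with pair-slot-injective eq
    ... | refl , l≡l′ = cong (_ ,_) (indexMaybe-injective (label p) (label q) l≡l′)
    slot-injective p q (far e) (far e′) eq with pair-slot-injective eq
    ... | refl , l≡l′ = cong (_ ,_) (indexMaybe-injective (label p) (label q) l≡l′)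
    slot-injective p q (near e) (far e′) eq with pair-slot-injective eq
    ... | refl , _ = ⊥-elim (proj₂ xs-indep p q (inj₂ (inj₂ (near-far-joined e))))
    slot-injective p q (far e) (near e′) eq with pair-slot-injective eq
    ... | refl , _ = ⊥-elim (proj₂ xs-indep p q (inj₂ (inj₂ (Joined-sym (near-far-joined e)))))

    length≤ : length xs ≤ t + k * suc (length S)
    length≤ = injectiveOn⇒length≤ (proj₁ xs-indep) (λ {x} p → slot (copy (proj₁ x)) (label p))
      λ {x} {y} p q → slot-injective p q (copy (proj₁ x)) (copy (proj₁ y))

  module LowerBound {I : List (Fin m)} (I-indep : IsIndependent (Adj G) I) where

    labels : List (Maybe (Fin m))
    labels = nothing ∷ map just I

    labels-unique : Unique labels
    labels-unique = All.map⁺ (All.universal (λ _ ()) I) ∷ Unique.map⁺ just-injective (proj₁ I-indep)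

    just∈labels⇒∈ : ∀ {u} → just u ∈ labels → u ∈ I
    just∈labels⇒∈ (Any.there p) with ∈-map⁻ just p
    ... | _ , u∈I , refl = u∈I

    apexVertex : Fin t → Vertex
    apexVertex c = cliqueCopy c , nothing

    nearVertex : Fin k → Maybe (Fin m) → Vertex
    nearVertex e y = nearCopy e , y

    independentSet : List Vertex
    independentSet = map apexVertex (allFin t) ++ cartesianProductWith nearVertex (allFin k) labels

    data Chosen : Vertex → Set where
      apex : (c : Fin t) → Chosen (apexVertex c)
      near : (e : Fin k) {y : Maybe (Fin m)} → y ∈ labels → Chosen (nearVertex e y)

    chosen : ∀ {x} → x ∈ independentSet → Chosen x
    chosen p with ∈-++⁻ (map apexVertex (allFin t)) p
    ... | inj₁ q with ∈-map⁻ apexVertex q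
    ...   | c , _ , refl = apex c
    chosen p | inj₂ q with ∈-cartesianProductWith⁻ nearVertex (allFin k) labels q
    ...   | e , _ , _ , y∈ , refl = near e y∈

    chosen-nonadjacent : ∀ {x y} → Chosen x → Chosen y → ¬ Shu x y
    chosen-nonadjacent (apex _)   _           (inj₁ (_ , _ , () , _))
    chosen-nonadjacent (near _ _) (apex _)    (inj₁ (_ , _ , _ , () , _))
    chosen-nonadjacent (near _ p) (near _ q)  (inj₁ (_ , _ , refl , refl , uv)) =
      proj₂ I-indep (just∈labels⇒∈ p) (just∈labels⇒∈ q) uv
    chosen-nonadjacent (apex _)   (apex _)    (inj₂ (inj₁ (_ , _ , y≢y′))) = y≢y′ refl
    chosen-nonadjacent (apex c)   (near _ _)  (inj₂ (inj₁ (i≡j , _)))     = ↑ˡ≢↑ʳ c _ i≡j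
    chosen-nonadjacent (near _ _) _           (inj₂ (inj₁ (_ , i<t , _))) = <⇒≱ i<t (t≤toℕ-pair _)
    chosen-nonadjacent (apex c)   _           (inj₂ (inj₂ (t≤i , _)))     = <⇒≱ (toℕ-cliqueCopy<t c) t≤i
    chosen-nonadjacent (near _ _) (apex c)    (inj₂ (inj₂ (_ , t≤j , _))) = <⇒≱ (toℕ-cliqueCopy<t c) t≤j
    chosen-nonadjacent (near e _) (near e′ _) (inj₂ (inj₂ joined))        = near-near-unjoined e e′ joined

    independentSet-unique : Unique independentSet
    independentSet-unique = Unique.++⁺
      (Unique.map⁺ (λ eq → ↑ˡ-injective (k + k) _ _ (cong proj₁ eq)) (Unique.allFin⁺ t))
      (Unique.cartesianProductWith⁺ nearVertex
        (λ eq → ↑ˡ-injective k _ _ (↑ʳ-injective t _ _ (cong proj₁ eq)) , cong proj₂ eq)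
        (Unique.allFin⁺ k) labels-unique)
      λ (p , q) → apex≢near p q
      where
      apex≢near : ∀ {x} → x ∈ map apexVertex (allFin t) →
        x ∈ cartesianProductWith nearVertex (allFin k) labels → ⊥
      apex≢near p q with ∈-map⁻ apexVertex p | ∈-cartesianProductWith⁻ nearVertex (allFin k) labels q
      ... | c , _ , refl | _ , _ , _ , _ , eq = ↑ˡ≢↑ʳ c _ (cong proj₁ eq)

    independentSet-independent : IsIndependent Shu independentSet
    independentSet-independent =
      independentSet-unique , λ p q → chosen-nonadjacent (chosen p) (chosen q)

    length-independentSet : length independentSet ≡ t + k * suc (length I)
    length-independentSet = begin
      length independentSet
        ≡⟨ length-++ (map apexVertex (allFin t)) ⟩
      length (map apexVertex (allFin t)) + length (cartesianProductWith nearVertex (allFin k) labels)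
        ≡⟨ cong₂ _+_ (trans (length-map apexVertex (allFin t)) (length-tabulate {n = t} _))
                     (length-cartesianProductWith nearVertex (allFin k) labels) ⟩
      t + length (allFin k) * suc (length (map just I))
        ≡⟨ cong₂ (λ a b → t + a * suc b) (length-tabulate {n = k} _) (length-map just I) ⟩
      t + k * suc (length I) ∎
      where open ≡-Reasoning

  independenceNumber : ∀ {α} → IsIndependenceNumber (Adj G) α →
    IsIndependenceNumber Shu (t + k * suc α)
  independenceNumber ((I , I-indep , refl) , α-max) =
    (independentSet , independentSet-independent , length-independentSet) ,
    λ xs xs-indep → ≤-trans (length≤ xs-indep)
      (+-monoʳ-≤ t (*-monoʳ-≤ k (s≤s (α-max _ (shadow-independent {G = G} xs-indep)))))
    where
    open LowerBound I-indep
    open UpperBound using (length≤)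

mainTheorem3 : (m : ℕ) (G : SimpleGraph (Fin m)) (t n : ℕ) →
    1 ≤ t → 1 ≤ n → t ≤ n → (∃ λ k → n ∸ t ≡ 2 * k) →
    (αG : ℕ) → IsIndependenceNumber (Adj G) αG →
    IsIndependenceNumber (ShuAdj t n G) (t + ((n ∸ t) / 2) * (αG + 1))
-- The formula also holds for t = 0.
mainTheorem3 m G t n _ _ t≤n (k , n∸t≡2k) αG αG-isα =
  subst₂ (λ n′ s → IsIndependenceNumber (ShuAdj t n′ G) s) (sym n≡t+[k+k]) (sym size≡)
    (Shuriken.independenceNumber G t k αG-isα)
  where
  n≡t+[k+k] : n ≡ t + (k + k)
  n≡t+[k+k] = begin
    n             ≡⟨ sym (m+[n∸m]≡n t≤n) ⟩
    t + (n ∸ t)   ≡⟨ cong (t +_) n∸t≡2k ⟩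
    t + 2 * k     ≡⟨ cong (λ b → t + (k + b)) (+-identityʳ k) ⟩
    t + (k + k)   ∎
    where open ≡-Reasoning
  size≡ : t + ((n ∸ t) / 2) * (αG + 1) ≡ t + k * suc αG
  size≡ = cong₂ (λ a b → t + a * b)
    (trans (cong (_/ 2) (trans n∸t≡2k (*-comm 2 k))) (m*n/n≡m k 2))
    (+-comm αG 1)
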